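{- Let $\mathcal{H}=(V,E)$ be a $3$-uniform hypergraph of girth at least $4$. If $M_\mathcal{H}\in\mathbb{B}_2^1$, then $\mathcal{H}$ has a majority $2$-colouring.
   Context: $\mathbb{B}_2^1$ is the monoid variety generated by the Brandt monoid ${\bf B}_2^1=\langle \mathsf{a},\mathsf{b}\mid \mathsf{a}\mathsf{b}\mathsf{a}=\mathsf{a},\ \mathsf{b}\mathsf{a}\mathsf{b}=\mathsf{b},\ \mathsf{a}\mathsf{a}=\mathsf{b}\mathsf{b}=0\rangle$. A majority $2$-colouring of $\mathcal{H}$ is a map $\gamma:V\to\{0,1\}$ such that every hyperedge has exactly two vertices of colour $1$ and one of colour $0$. Hypergraphs have no isolated vertices; girth is the length of a shortest cycle (a cycle being $v_0,e_0,\dots,v_{n-1},e_{n-1}$ with distinct vertices, distinct hyperedges and $v_{i+1}\in e_i\cap e_{i+1}$, indices mod $n$). For $2$-subsets of $V$, $\{u,v\}\equiv\{x,y\}$ iff there is $w$ with $\{u,v,w\},\{x,y,w\}\in E$, or neither is contained in a hyperedge. $M_\mathcal{H}$ is the monoid with identity $1$ generated by a zero $0$, an element $\mathsf{t}$ and the elements of $V$ subject to: $\mathsf{t}^2=\mathsf{t}u\mathsf{t}=\mathsf{t}uv\mathsf{t}=0$ ($u,v\in V$); $uv=vu$; $uu=0$; $uv=0$ whenever no hyperedge contains $\{u,v\}$; $\mathsf{t}uvw\mathsf{t}=\mathsf{t}$ for $\{u,v,w\}\in E$; $uvw=u'v'w'$ for all $\{u,v,w\},\{u',v',w'\}\in E$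 (this element is $\mathsf{e}$); $\mathsf{e}\mathsf{t}\mathsf{e}=\mathsf{e}$; and $uv=u'v'$ whenever $\{u,v\}\equiv\{u',v'\}$. -}

module Defs where

open import Level using (0ℓ)
open import Data.Nat using (ℕ; zero; suc; _≤_; _<_)
open import Data.Nat.DivMod using (_mod_)
open import Data.Fin using (Fin; toℕ)
open import Data.Fin.Subset using (Subset; _∈_; _∪_; _∩_; ⁅_⁆; ∣_∣)
open import Data.Bool using (Bool)
open import Data.Vec using (tabulate)
open import Data.List using (List; []; _∷_; _++_; concatMap)
open import Data.List.Properties using (++-assoc; ++-identityˡ; ++-identityʳ)
open import Data.Product using (Σ; ∃; ∃-syntax; _×_; _,_)
open import Data.Sum using (_⊎_)
open import Function using (Injective)
open import Relation.Nullary using (¬_)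
open import Relation.Unary using (Decidable)
open import Relation.Binary.PropositionalEquality as P using (_≡_; _≢_; refl)
open import Relation.Binary.Structures using (IsEquivalence)
open import Algebra.Bundles using (Monoid)
open import Algebra.Structures using (IsMonoid; IsSemigroup; IsMagma)

record Hypergraph3 (n : ℕ) : Set₁ where
  field
    E          : Subset n → Set
    E?         : Decidable E
    uniform    : ∀ {e} → E e → ∣ e ∣ ≡ 3
    noIsolated : ∀ v → ∃[ e ] (E e × v ∈ e)

open Hypergraph3 public

triple : ∀ {n} → Fin n → Fin n → Fin n → Subset n
triple u v w = ⁅ u ⁆ ∪ (⁅ v ⁆ ∪ ⁅ w ⁆)

IsEdge : ∀ {n} → Hypergraph3 n → Fin n → Fin n → Fin n → Set
IsEdge H u v w = E H (triple u v w)

NotCovered : ∀ {n} → Hypergraph3 n → Fin n → Fin n → Set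
NotCovered H u v = ¬ (∃[ e ] (E H e × u ∈ e × v ∈ e))

next : ∀ {k} → Fin (suc k) → Fin (suc k)
next {k} i = suc (toℕ i) mod suc k

record Cycle {n} (H : Hypergraph3 n) (k : ℕ) : Set where
  field
    vs      : Fin (suc k) → Fin n
    es      : Fin (suc k) → Subset n
    es-edge : ∀ i → E H (es i)
    vs-inj  : Injective _≡_ _≡_ vs
    es-inj  : Injective _≡_ _≡_ es
    link    : ∀ i → vs (next i) ∈ es i × vs (next i) ∈ es (next i)

-- girth ≥ g : there is no cycle of length ℓ with 2 ≤ ℓ < g
-- (a cycle of length suc k is a  Cycle H k ; cycles have length ≥ 2).
GirthAtLeast : ∀ {n} → Hypergraph3 n → ℕ → Set
GirthAtLeast H g = ∀ k → 2 ≤ suc k → suc k < g → ¬ Cycle H k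

-- Majority 2-colouring: γ : V → Bool (true = colour 1) such that every
-- hyperedge has exactly two vertices of colour 1 (and, being a 3-set,
-- exactly one of colour 0).

IsMajority2Colouring : ∀ {n} → Hypergraph3 n → (Fin n → Bool) → Set
IsMajority2Colouring H γ = ∀ e → E H e → ∣ e ∩ tabulate γ ∣ ≡ 2

Term : Set
Term = List ℕ

module _ {c ℓ} (M : Monoid c ℓ) where
  open Monoid M
  eval : (ℕ → Carrier) → Term → Carrier
  eval σ []       = ε
  eval σ (x ∷ xs) = σ x ∙ eval σ xs

  Satisfies : Term → Term → Set (c Level.⊔ ℓ)
  Satisfies s t = ∀ (σ : ℕ → Carrier) → eval σ s ≈ eval σ t

-- The Brandt monoid B₂¹ = {𝟎, 𝟏, a, b, ab, ba}, realised by matrix units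
-- a = e₁₂, b = e₂₁, ab = e₁₁, ba = e₂₂ together with 0 and 1.
-- It satisfies aba = a, bab = b, aa = bb = 0.

data B₂¹ : Set where
  𝟎 𝟏 a b ab ba : B₂¹

infixl 7 _·ᴮ_
_·ᴮ_ : B₂¹ → B₂¹ → B₂¹
𝟎 ·ᴮ 𝟎 = 𝟎
𝟎 ·ᴮ 𝟏 = 𝟎
𝟎 ·ᴮ a = 𝟎
𝟎 ·ᴮ b = 𝟎
𝟎 ·ᴮ ab = 𝟎
𝟎 ·ᴮ ba = 𝟎
𝟏 ·ᴮ 𝟎 = 𝟎
𝟏 ·ᴮ 𝟏 = 𝟏
𝟏 ·ᴮ a = a
𝟏 ·ᴮ b = b
𝟏 ·ᴮ ab = ab
𝟏 ·ᴮ ba = ba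
a ·ᴮ 𝟎 = 𝟎
a ·ᴮ 𝟏 = a
a ·ᴮ a = 𝟎
a ·ᴮ b = ab
a ·ᴮ ab = 𝟎
a ·ᴮ ba = a
b ·ᴮ 𝟎 = 𝟎
b ·ᴮ 𝟏 = b
b ·ᴮ a = ba
b ·ᴮ b = 𝟎
b ·ᴮ ab = b
b ·ᴮ ba = 𝟎
ab ·ᴮ 𝟎 = 𝟎
ab ·ᴮ 𝟏 = ab
ab ·ᴮ a = a
ab ·ᴮ b = 𝟎
ab ·ᴮ ab = ab
ab ·ᴮ ba = 𝟎
ba ·ᴮ 𝟎 = 𝟎
ba ·ᴮ 𝟏 = ba
ba ·ᴮ a = 𝟎
ba ·ᴮ b = b
ba ·ᴮ ab = 𝟎
ba ·ᴮ ba = ba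

·ᴮ-assoc : ∀ x y z → (x ·ᴮ y) ·ᴮ z ≡ x ·ᴮ (y ·ᴮ z)
·ᴮ-assoc 𝟎 𝟎 𝟎 = refl
·ᴮ-assoc 𝟎 𝟎 𝟏 = refl
·ᴮ-assoc 𝟎 𝟎 a = refl
·ᴮ-assoc 𝟎 𝟎 b = refl
·ᴮ-assoc 𝟎 𝟎 ab = refl
·ᴮ-assoc 𝟎 𝟎 ba = refl
·ᴮ-assoc 𝟎 𝟏 𝟎 = refl
·ᴮ-assoc 𝟎 𝟏 𝟏 = refl
·ᴮ-assoc 𝟎 𝟏 a = refl
·ᴮ-assoc 𝟎 𝟏 b = refl
·ᴮ-assoc 𝟎 𝟏 ab = refl
·ᴮ-assoc 𝟎 𝟏 ba = refl
·ᴮ-assoc 𝟎 a 𝟎 = refl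
·ᴮ-assoc 𝟎 a 𝟏 = refl
·ᴮ-assoc 𝟎 a a = refl
·ᴮ-assoc 𝟎 a b = refl
·ᴮ-assoc 𝟎 a ab = refl
·ᴮ-assoc 𝟎 a ba = refl
·ᴮ-assoc 𝟎 b 𝟎 = refl
·ᴮ-assoc 𝟎 b 𝟏 = refl
·ᴮ-assoc 𝟎 b a = refl
·ᴮ-assoc 𝟎 b b = refl
·ᴮ-assoc 𝟎 b ab = refl
·ᴮ-assoc 𝟎 b ba = refl
·ᴮ-assoc 𝟎 ab 𝟎 = refl
·ᴮ-assoc 𝟎 ab 𝟏 = refl
·ᴮ-assoc 𝟎 ab a = refl
·ᴮ-assoc 𝟎 ab b = refl
·ᴮ-assoc 𝟎 ab ab = refl
·ᴮ-assoc 𝟎 ab ba = refl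
·ᴮ-assoc 𝟎 ba 𝟎 = refl
·ᴮ-assoc 𝟎 ba 𝟏 = refl
·ᴮ-assoc 𝟎 ba a = refl
·ᴮ-assoc 𝟎 ba b = refl
·ᴮ-assoc 𝟎 ba ab = refl
·ᴮ-assoc 𝟎 ba ba = refl
·ᴮ-assoc 𝟏 𝟎 𝟎 = refl
·ᴮ-assoc 𝟏 𝟎 𝟏 = refl
·ᴮ-assoc 𝟏 𝟎 a = refl
·ᴮ-assoc 𝟏 𝟎 b = refl
·ᴮ-assoc 𝟏 𝟎 ab = refl
·ᴮ-assoc 𝟏 𝟎 ba = refl
·ᴮ-assoc 𝟏 𝟏 𝟎 = refl
·ᴮ-assoc 𝟏 𝟏 𝟏 = refl
·ᴮ-assoc 𝟏 𝟏 a = refl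
·ᴮ-assoc 𝟏 𝟏 b = refl
·ᴮ-assoc 𝟏 𝟏 ab = refl
·ᴮ-assoc 𝟏 𝟏 ba = refl
·ᴮ-assoc 𝟏 a 𝟎 = refl
·ᴮ-assoc 𝟏 a 𝟏 = refl
·ᴮ-assoc 𝟏 a a = refl
·ᴮ-assoc 𝟏 a b = refl
·ᴮ-assoc 𝟏 a ab = refl
·ᴮ-assoc 𝟏 a ba = refl
·ᴮ-assoc 𝟏 b 𝟎 = refl
·ᴮ-assoc 𝟏 b 𝟏 = refl
·ᴮ-assoc 𝟏 b a = refl
·ᴮ-assoc 𝟏 b b = refl
·ᴮ-assoc 𝟏 b ab = refl
·ᴮ-assoc 𝟏 b ba = refl
·ᴮ-assoc 𝟏 ab 𝟎 = refl
·ᴮ-assoc 𝟏 ab 𝟏 = refl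
·ᴮ-assoc 𝟏 ab a = refl
·ᴮ-assoc 𝟏 ab b = refl
·ᴮ-assoc 𝟏 ab ab = refl
·ᴮ-assoc 𝟏 ab ba = refl
·ᴮ-assoc 𝟏 ba 𝟎 = refl
·ᴮ-assoc 𝟏 ba 𝟏 = refl
·ᴮ-assoc 𝟏 ba a = refl
·ᴮ-assoc 𝟏 ba b = refl
·ᴮ-assoc 𝟏 ba ab = refl
·ᴮ-assoc 𝟏 ba ba = refl
·ᴮ-assoc a 𝟎 𝟎 = refl
·ᴮ-assoc a 𝟎 𝟏 = refl
·ᴮ-assoc a 𝟎 a = refl
·ᴮ-assoc a 𝟎 b = refl
·ᴮ-assoc a 𝟎 ab = refl
·ᴮ-assoc a 𝟎 ba = refl
·ᴮ-assoc a 𝟏 𝟎 = refl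
·ᴮ-assoc a 𝟏 𝟏 = refl
·ᴮ-assoc a 𝟏 a = refl
·ᴮ-assoc a 𝟏 b = refl
·ᴮ-assoc a 𝟏 ab = refl
·ᴮ-assoc a 𝟏 ba = refl
·ᴮ-assoc a a 𝟎 = refl
·ᴮ-assoc a a 𝟏 = refl
·ᴮ-assoc a a a = refl
·ᴮ-assoc a a b = refl
·ᴮ-assoc a a ab = refl
·ᴮ-assoc a a ba = refl
·ᴮ-assoc a b 𝟎 = refl
·ᴮ-assoc a b 𝟏 = refl
·ᴮ-assoc a b a = refl
·ᴮ-assoc a b b = refl
·ᴮ-assoc a b ab = refl
·ᴮ-assoc a b ba = refl
·ᴮ-assoc a ab 𝟎 = refl
·ᴮ-assoc a ab 𝟏 = refl
·ᴮ-assoc a ab a = refl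
·ᴮ-assoc a ab b = refl
·ᴮ-assoc a ab ab = refl
·ᴮ-assoc a ab ba = refl
·ᴮ-assoc a ba 𝟎 = refl
·ᴮ-assoc a ba 𝟏 = refl
·ᴮ-assoc a ba a = refl
·ᴮ-assoc a ba b = refl
·ᴮ-assoc a ba ab = refl
·ᴮ-assoc a ba ba = refl
·ᴮ-assoc b 𝟎 𝟎 = refl
·ᴮ-assoc b 𝟎 𝟏 = refl
·ᴮ-assoc b 𝟎 a = refl
·ᴮ-assoc b 𝟎 b = refl
·ᴮ-assoc b 𝟎 ab = refl
·ᴮ-assoc b 𝟎 ba = refl
·ᴮ-assoc b 𝟏 𝟎 = refl
·ᴮ-assoc b 𝟏 𝟏 = refl
·ᴮ-assoc b 𝟏 a = refl
·ᴮ-assoc b 𝟏 b = refl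
·ᴮ-assoc b 𝟏 ab = refl
·ᴮ-assoc b 𝟏 ba = refl
·ᴮ-assoc b a 𝟎 = refl
·ᴮ-assoc b a 𝟏 = refl
·ᴮ-assoc b a a = refl
·ᴮ-assoc b a b = refl
·ᴮ-assoc b a ab = refl
·ᴮ-assoc b a ba = refl
·ᴮ-assoc b b 𝟎 = refl
·ᴮ-assoc b b 𝟏 = refl
·ᴮ-assoc b b a = refl
·ᴮ-assoc b b b = refl
·ᴮ-assoc b b ab = refl
·ᴮ-assoc b b ba = refl
·ᴮ-assoc b ab 𝟎 = refl
·ᴮ-assoc b ab 𝟏 = refl
·ᴮ-assoc b ab a = refl
·ᴮ-assoc b ab b = refl
·ᴮ-assoc b ab ab = refl
·ᴮ-assoc b ab ba = refl
·ᴮ-assoc b ba 𝟎 = refl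
·ᴮ-assoc b ba 𝟏 = refl
·ᴮ-assoc b ba a = refl
·ᴮ-assoc b ba b = refl
·ᴮ-assoc b ba ab = refl
·ᴮ-assoc b ba ba = refl
·ᴮ-assoc ab 𝟎 𝟎 = refl
·ᴮ-assoc ab 𝟎 𝟏 = refl
·ᴮ-assoc ab 𝟎 a = refl
·ᴮ-assoc ab 𝟎 b = refl
·ᴮ-assoc ab 𝟎 ab = refl
·ᴮ-assoc ab 𝟎 ba = refl
·ᴮ-assoc ab 𝟏 𝟎 = refl
·ᴮ-assoc ab 𝟏 𝟏 = refl
·ᴮ-assoc ab 𝟏 a = refl
·ᴮ-assoc ab 𝟏 b = refl
·ᴮ-assoc ab 𝟏 ab = refl
·ᴮ-assoc ab 𝟏 ba = refl
·ᴮ-assoc ab a 𝟎 = refl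
·ᴮ-assoc ab a 𝟏 = refl
·ᴮ-assoc ab a a = refl
·ᴮ-assoc ab a b = refl
·ᴮ-assoc ab a ab = refl
·ᴮ-assoc ab a ba = refl
·ᴮ-assoc ab b 𝟎 = refl
·ᴮ-assoc ab b 𝟏 = refl
·ᴮ-assoc ab b a = refl
·ᴮ-assoc ab b b = refl
·ᴮ-assoc ab b ab = refl
·ᴮ-assoc ab b ba = refl
·ᴮ-assoc ab ab 𝟎 = refl
·ᴮ-assoc ab ab 𝟏 = refl
·ᴮ-assoc ab ab a = refl
·ᴮ-assoc ab ab b = refl
·ᴮ-assoc ab ab ab = refl
·ᴮ-assoc ab ab ba = refl
·ᴮ-assoc ab ba 𝟎 = refl
·ᴮ-assoc ab ba 𝟏 = refl
·ᴮ-assoc ab ba a = refl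
·ᴮ-assoc ab ba b = refl
·ᴮ-assoc ab ba ab = refl
·ᴮ-assoc ab ba ba = refl
·ᴮ-assoc ba 𝟎 𝟎 = refl
·ᴮ-assoc ba 𝟎 𝟏 = refl
·ᴮ-assoc ba 𝟎 a = refl
·ᴮ-assoc ba 𝟎 b = refl
·ᴮ-assoc ba 𝟎 ab = refl
·ᴮ-assoc ba 𝟎 ba = refl
·ᴮ-assoc ba 𝟏 𝟎 = refl
·ᴮ-assoc ba 𝟏 𝟏 = refl
·ᴮ-assoc ba 𝟏 a = refl
·ᴮ-assoc ba 𝟏 b = refl
·ᴮ-assoc ba 𝟏 ab = refl
·ᴮ-assoc ba 𝟏 ba = refl
·ᴮ-assoc ba a 𝟎 = refl
·ᴮ-assoc ba a 𝟏 = refl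
·ᴮ-assoc ba a a = refl
·ᴮ-assoc ba a b = refl
·ᴮ-assoc ba a ab = refl
·ᴮ-assoc ba a ba = refl
·ᴮ-assoc ba b 𝟎 = refl
·ᴮ-assoc ba b 𝟏 = refl
·ᴮ-assoc ba b a = refl
·ᴮ-assoc ba b b = refl
·ᴮ-assoc ba b ab = refl
·ᴮ-assoc ba b ba = refl
·ᴮ-assoc ba ab 𝟎 = refl
·ᴮ-assoc ba ab 𝟏 = refl
·ᴮ-assoc ba ab a = refl
·ᴮ-assoc ba ab b = refl
·ᴮ-assoc ba ab ab = refl
·ᴮ-assoc ba ab ba = refl
·ᴮ-assoc ba ba 𝟎 = refl
·ᴮ-assoc ba ba 𝟏 = refl
·ᴮ-assoc ba ba a = refl
·ᴮ-assoc ba ba b = refl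
·ᴮ-assoc ba ba ab = refl
·ᴮ-assoc ba ba ba = refl

·ᴮ-identityˡ : ∀ x → 𝟏 ·ᴮ x ≡ x
·ᴮ-identityˡ 𝟎 = refl
·ᴮ-identityˡ 𝟏 = refl
·ᴮ-identityˡ a = refl
·ᴮ-identityˡ b = refl
·ᴮ-identityˡ ab = refl
·ᴮ-identityˡ ba = refl

·ᴮ-identityʳ : ∀ x → x ·ᴮ 𝟏 ≡ x
·ᴮ-identityʳ 𝟎 = refl
·ᴮ-identityʳ 𝟏 = refl
·ᴮ-identityʳ a = refl
·ᴮ-identityʳ b = refl
·ᴮ-identityʳ ab = refl
·ᴮ-identityʳ ba = refl

B₂¹-monoid : Monoid 0ℓ 0ℓ
B₂¹-monoid = record
  { Carrier = B₂¹ ; _≈_ = _≡_ ; _∙_ = _·ᴮ_ ; ε = 𝟏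
  ; isMonoid = record
    { isSemigroup = record
      { isMagma = record { isEquivalence = P.isEquivalence ; ∙-cong = P.cong₂ _·ᴮ_ }
      ; assoc = ·ᴮ-assoc }
    ; identity = ·ᴮ-identityˡ , ·ᴮ-identityʳ } }

-- A monoid M lies in the variety 𝔹₂¹ generated by B₂¹ iff it satisfies
-- every identity satisfied by B₂¹ (Birkhoff).
In𝔹₂¹ : ∀ {c ℓ} → Monoid c ℓ → Set (c Level.⊔ ℓ)
In𝔹₂¹ M = ∀ s t → Satisfies B₂¹-monoid s t → Satisfies M s t

data Gen (n : ℕ) : Set where
  𝟘 𝐭 : Gen n
  ⟨_⟩ : Fin n → Gen n

Word : ℕ → Set
Word n = List (Gen n)

module _ {n} (H : Hypergraph3 n) where

  -- {u,v} ≡ {x,y} for 2-subsets (u ≢ v, x ≢ y are required separately)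
  PairEquiv : Fin n → Fin n → Fin n → Fin n → Set
  PairEquiv u v x y =
    (∃[ w ] (IsEdge H u v w × IsEdge H x y w))
    ⊎ (NotCovered H u v × NotCovered H x y)

  data Rel : Word n → Word n → Set where
    zeroˡ  : ∀ g → Rel (𝟘 ∷ g ∷ []) (𝟘 ∷ [])
    zeroʳ  : ∀ g → Rel (g ∷ 𝟘 ∷ []) (𝟘 ∷ [])
    tt     : Rel (𝐭 ∷ 𝐭 ∷ []) (𝟘 ∷ [])
    tut    : ∀ u → Rel (𝐭 ∷ ⟨ u ⟩ ∷ 𝐭 ∷ []) (𝟘 ∷ [])
    tuvt   : ∀ u v → Rel (𝐭 ∷ ⟨ u ⟩ ∷ ⟨ v ⟩ ∷ 𝐭 ∷ []) (𝟘 ∷ [])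
    comm   : ∀ u v → Rel (⟨ u ⟩ ∷ ⟨ v ⟩ ∷ []) (⟨ v ⟩ ∷ ⟨ u ⟩ ∷ [])
    square : ∀ u → Rel (⟨ u ⟩ ∷ ⟨ u ⟩ ∷ []) (𝟘 ∷ [])
    uncov  : ∀ u v → NotCovered H u v → Rel (⟨ u ⟩ ∷ ⟨ v ⟩ ∷ []) (𝟘 ∷ [])
    tuvwt  : ∀ u v w → IsEdge H u v w →
             Rel (𝐭 ∷ ⟨ u ⟩ ∷ ⟨ v ⟩ ∷ ⟨ w ⟩ ∷ 𝐭 ∷ []) (𝐭 ∷ [])
    edges  : ∀ u v w u′ v′ w′ → IsEdge H u v w → IsEdge H u′ v′ w′ →
             Rel (⟨ u ⟩ ∷ ⟨ v ⟩ ∷ ⟨ w ⟩ ∷ []) (⟨ u′ ⟩ ∷ ⟨ v′ ⟩ ∷ ⟨ w′ ⟩ ∷ [])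
    ete    : ∀ u v w → IsEdge H u v w →
             Rel (⟨ u ⟩ ∷ ⟨ v ⟩ ∷ ⟨ w ⟩ ∷ 𝐭 ∷ ⟨ u ⟩ ∷ ⟨ v ⟩ ∷ ⟨ w ⟩ ∷ [])
                 (⟨ u ⟩ ∷ ⟨ v ⟩ ∷ ⟨ w ⟩ ∷ [])
    pairs  : ∀ u v x y → u ≢ v → x ≢ y → PairEquiv u v x y →
             Rel (⟨ u ⟩ ∷ ⟨ v ⟩ ∷ []) (⟨ x ⟩ ∷ ⟨ y ⟩ ∷ [])

  infix 4 _∼_
  data _∼_ : Word n → Word n → Set where
    step  : ∀ {l r} → Rel l r → ∀ p s → p ++ l ++ s ∼ p ++ r ++ s
    ∼refl  : ∀ {x} → x ∼ x
    ∼sym   : ∀ {x y} → x ∼ y → y ∼ x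
    ∼trans : ∀ {x y z} → x ∼ y → y ∼ z → x ∼ z

  ∼-congʳ : ∀ {x x′} y → x ∼ x′ → x ++ y ∼ x′ ++ y
  ∼-congʳ y (step {l} {r} ρ p s)
    rewrite ++-assoc p (l ++ s) y | ++-assoc l s y
          | ++-assoc p (r ++ s) y | ++-assoc r s y = step ρ p (s ++ y)
  ∼-congʳ y ∼refl = ∼refl
  ∼-congʳ y (∼sym q) = ∼sym (∼-congʳ y q)
  ∼-congʳ y (∼trans q q′) = ∼trans (∼-congʳ y q) (∼-congʳ y q′)

  ∼-congˡ : ∀ x {y y′} → y ∼ y′ → x ++ y ∼ x ++ y′
  ∼-congˡ x (step {l} {r} ρ p s)
    rewrite P.sym (++-assoc x p (l ++ s))
          | P.sym (++-assoc x p (r ++ s)) = step ρ (x ++ p) s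
  ∼-congˡ x ∼refl = ∼refl
  ∼-congˡ x (∼sym q) = ∼sym (∼-congˡ x q)
  ∼-congˡ x (∼trans q q′) = ∼trans (∼-congˡ x q) (∼-congˡ x q′)

  ≡⇒∼ : ∀ {x y} → x ≡ y → x ∼ y
  ≡⇒∼ refl = ∼refl

  M : Monoid 0ℓ 0ℓ
  M = record
    { Carrier = Word n ; _≈_ = _∼_ ; _∙_ = _++_ ; ε = []
    ; isMonoid = record
      { isSemigroup = record
        { isMagma = record
          { isEquivalence = record { refl = ∼refl ; sym = ∼sym ; trans = ∼trans }
          ; ∙-cong = λ {x} {x′} {y} {y′} p q → ∼trans (∼-congʳ y p) (∼-congˡ x′ q) }
        ; assoc = λ x y z → ≡⇒∼ (++-assoc x y z) }
      ; identity = (λ x → ≡⇒∼ (++-identityˡ x)) , (λ x → ≡⇒∼ (++-identityʳ x)) } }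

-- Let W be the word 𝐭 u₁v₁w₁ 𝐭 u₂v₂w₂ ⋯ 𝐭 uₖvₖwₖ 𝐭, where (uᵢ, vᵢ, wᵢ) runs over
-- all ordered triples spanning an edge.  In M_H the words W and W𝐭 differ: M_H
-- acts on a small automaton that reads edges letter by letter (well defined
-- because two vertices lie in at most one edge), and there W sends the state
-- "edge complete" to "start" while W𝐭 sends it to the dead state.  On the other
-- hand, if an assignment σ into B₂¹ separates W from W𝐭, then σ(𝐭) is a or b and
-- every σ(𝐭) σ(u) σ(v) σ(w) σ(𝐭) with {u, v, w} ∈ E is non-zero, which forces
-- exactly two of σ(u), σ(v), σ(w) to be 1; so v ↦ [σ(v) = 1] is a majority
-- 2-colouring.  Since the existence of such a colouring is decidable, an
-- uncolourable H would give an identity of B₂¹ failing in M_H.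

module Submission where

open import Defs
open import Data.Nat using (ℕ; zero; suc; _+_; _≤_; s≤s; _<?_)
import Data.Nat.Properties as ℕₚ
open import Data.Fin using (Fin; zero; suc; toℕ; fromℕ<)
import Data.Fin.Properties as Finₚ
open import Data.Fin.Properties using (any?)
open import Data.Fin.Subset using (Subset; _∈_; _∉_; _∪_; _∩_; ⁅_⁆; ∣_∣; ⊥)
open import Data.Fin.Subset.Properties
  using (anySubset?; ⊆-antisym; q⊆p∪q; x∈p∪q⁻; x∈p∪q⁺; x∈⁅x⁆; x∈⁅y⁆⇒x≡y; x≢y⇒x∉⁅y⁆; ∉⊥;
         ∣p∣≤∣x∷p∣; ∣⁅x⁆∣≡1; ∣⊥∣≡0; ∪-comm; ∪-assoc; ∪-idem; ∪-identityˡ; ∪-identityʳ; ∩-zeroˡ)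
open import Data.Bool using (Bool; true; false; _∧_; if_then_else_)
import Data.Bool.Properties as Boolₚ
open import Data.Vec using ([]; _∷_; lookup; tabulate; map; here; there)
open import Data.Vec.Properties using (lookup∘tabulate; tabulate∘lookup; map-cong)
import Data.Vec.Properties as Vecₚ
open import Data.List using (List; _++_; foldr; concatMap; filter; cartesianProduct; allFin)
  renaming ([] to []ₗ; _∷_ to _∷ₗ_; map to mapₗ)
open import Data.List.Properties using (foldr-++)
open import Data.List.Relation.Unary.All using (All) renaming ([] to []ᵃ; _∷_ to _∷ᵃ_)
open import Data.List.Relation.Unary.All.Properties using (all-filter)
open import Data.List.Relation.Unary.Any using (here; there)
import Data.List.Membership.Propositional as List
open import Data.List.Membership.Propositional.Properties
  using (∈-filter⁺; ∈-cartesianProduct⁺; ∈-allFin)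
open import Data.Product using (∃; ∃₂; _×_; _,_; proj₁)
open import Data.Sum using (_⊎_; inj₁; inj₂)
open import Data.Empty using (⊥-elim)
open import Function using (_∘_)
open import Relation.Nullary using (¬_; Dec; yes; no; does)
open import Relation.Nullary.Decidable
  using (map′; from-yes; ¬?; _→-dec_; decidable-stable; dec-true; dec-false)
open import Relation.Unary using (Decidable)
open import Relation.Binary using (DecidableEquality)
open import Relation.Binary.PropositionalEquality
  using (_≡_; _≢_; refl; sym; trans; cong; cong₂; subst; subst₂; module ≡-Reasoning)

private variable
  n : ℕ
  u v w : Fin n
  H : Hypergraph3 n

-- The Brandt monoid; being finite, its universal facts are decided by enumeration.

position : B₂¹ → Fin 6
position 𝟎  = zero
position 𝟏  = suc zero
position a  = suc (suc zero)
position b  = suc (suc (suc zero))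
position ab = suc (suc (suc (suc zero)))
position ba = suc (suc (suc (suc (suc zero))))

element : Fin 6 → B₂¹
element zero                                = 𝟎
element (suc zero)                          = 𝟏
element (suc (suc zero))                    = a
element (suc (suc (suc zero)))              = b
element (suc (suc (suc (suc zero))))        = ab
element (suc (suc (suc (suc (suc zero))))) = ba

element-position : ∀ x → element (position x) ≡ x
element-position 𝟎  = refl
element-position 𝟏  = refl
element-position a  = refl
element-position b  = refl
element-position ab = refl
element-position ba = refl

infix 4 _≟ᴮ_
_≟ᴮ_ : DecidableEquality B₂¹
x ≟ᴮ y = map′ (λ eq → trans (sym (element-position x)) (trans (cong element eq) (element-position y)))
              (cong position) (position x Finₚ.≟ position y)

∀ᴮ? : ∀ {p} {P : B₂¹ → Set p} → Decidable P → Dec (∀ x → P x)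
∀ᴮ? {P = P} P? = map′ (λ h x → subst P (element-position x) (h (position x)))
                      (λ h → h ∘ element) (Finₚ.all? (P? ∘ element))

·ᴮ-zeroˡ : ∀ x → 𝟎 ·ᴮ x ≡ 𝟎
·ᴮ-zeroˡ = from-yes (∀ᴮ? λ x → 𝟎 ·ᴮ x ≟ᴮ 𝟎)

·ᴮ-zeroʳ : ∀ x → x ·ᴮ 𝟎 ≡ 𝟎
·ᴮ-zeroʳ = from-yes (∀ᴮ? λ x → x ·ᴮ 𝟎 ≟ᴮ 𝟎)

isOne : B₂¹ → Bool
isOne x = does (x ≟ᴮ 𝟏)

sandwich : B₂¹ → B₂¹ → B₂¹ → B₂¹ → B₂¹
sandwich t x y z = t ·ᴮ (x ·ᴮ (y ·ᴮ (z ·ᴮ t)))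

-- t ·ᴮ t ≢ t leaves t ∈ {a, b}; a w a ≢ 𝟎 forces w ≡ b (dually for b), and a
-- product of x, y, z equal to b in all six orders has one factor b and two 𝟏.
two-ones-in-sandwiched-triple : ∀ t x y z → t ·ᴮ t ≢ t →
  sandwich t x y z ≢ 𝟎 → sandwich t x z y ≢ 𝟎 → sandwich t y x z ≢ 𝟎 →
  sandwich t y z x ≢ 𝟎 → sandwich t z x y ≢ 𝟎 → sandwich t z y x ≢ 𝟎 →
  ∣ isOne x ∷ isOne y ∷ isOne z ∷ [] ∣ ≡ 2
two-ones-in-sandwiched-triple = from-yes (∀ᴮ? λ t → ∀ᴮ? λ x → ∀ᴮ? λ y → ∀ᴮ? λ z →
  ¬? (t ·ᴮ t ≟ᴮ t) →-dec
  ¬? (sandwich t x y z ≟ᴮ 𝟎) →-dec ¬? (sandwich t x z y ≟ᴮ 𝟎) →-dec ¬? (sandwich t y x z ≟ᴮ 𝟎) →-dec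
  ¬? (sandwich t y z x ≟ᴮ 𝟎) →-dec ¬? (sandwich t z x y ≟ᴮ 𝟎) →-dec ¬? (sandwich t z y x ≟ᴮ 𝟎) →-dec
  ∣ isOne x ∷ isOne y ∷ isOne z ∷ [] ∣ ℕₚ.≟ 2)

allSubset? : ∀ {p} {P : Subset n → Set p} → Decidable P → Dec (∀ s → P s)
allSubset? P? = map′ (λ ∄¬P s → decidable-stable (P? s) (λ ¬Ps → ∄¬P (s , ¬Ps)))
                     (λ ∀P (s , ¬Ps) → ¬Ps (∀P s))
                     (¬? (anySubset? (¬? ∘ P?)))

x∈p⇒⁅x⁆∪p≡p : ∀ {x : Fin n} {p} → x ∈ p → ⁅ x ⁆ ∪ p ≡ p
x∈p⇒⁅x⁆∪p≡p {x = x} {p} x∈p = ⊆-antisym ⊆p (q⊆p∪q ⁅ x ⁆ p)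
  where
  ⊆p : ∀ {y} → y ∈ ⁅ x ⁆ ∪ p → y ∈ p
  ⊆p y∈ with x∈p∪q⁻ ⁅ x ⁆ p y∈
  ... | inj₁ y∈⁅x⁆ = subst (_∈ p) (sym (x∈⁅y⁆⇒x≡y x y∈⁅x⁆)) x∈p
  ... | inj₂ y∈p   = y∈p

∣⁅x⁆∪p∣≤1+∣p∣ : ∀ (x : Fin n) p → ∣ ⁅ x ⁆ ∪ p ∣ ≤ suc ∣ p ∣
∣⁅x⁆∪p∣≤1+∣p∣ zero    (s ∷ p)     rewrite ∪-identityˡ p = s≤s (∣p∣≤∣x∷p∣ s p)
∣⁅x⁆∪p∣≤1+∣p∣ (suc x) (true ∷ p)  = s≤s (∣⁅x⁆∪p∣≤1+∣p∣ x p)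
∣⁅x⁆∪p∣≤1+∣p∣ (suc x) (false ∷ p) = ∣⁅x⁆∪p∣≤1+∣p∣ x p

x∉⁅y⁆∪⁅z⁆ : ∀ {x y z : Fin n} → x ≢ y → x ≢ z → x ∉ ⁅ y ⁆ ∪ ⁅ z ⁆
x∉⁅y⁆∪⁅z⁆ {y = y} {z} x≢y x≢z x∈ with x∈p∪q⁻ ⁅ y ⁆ ⁅ z ⁆ x∈
... | inj₁ x∈⁅y⁆ = x≢y (x∈⁅y⁆⇒x≡y y x∈⁅y⁆)
... | inj₂ x∈⁅z⁆ = x≢z (x∈⁅y⁆⇒x≡y z x∈⁅z⁆)

∣x∷p∣≡∣x∷[]∣+∣p∣ : ∀ x (p : Subset n) → ∣ x ∷ p ∣ ≡ ∣ x ∷ [] ∣ + ∣ p ∣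
∣x∷p∣≡∣x∷[]∣+∣p∣ true  p = refl
∣x∷p∣≡∣x∷[]∣+∣p∣ false p = refl

x∉p⇒∣⁅x⁆∪p∩q∣≡∣q[x]∣+∣p∩q∣ : ∀ (x : Fin n) p q → x ∉ p →
                              ∣ (⁅ x ⁆ ∪ p) ∩ q ∣ ≡ ∣ lookup q x ∷ [] ∣ + ∣ p ∩ q ∣
x∉p⇒∣⁅x⁆∪p∩q∣≡∣q[x]∣+∣p∩q∣ zero (true ∷ p) q x∉p = ⊥-elim (x∉p here)
x∉p⇒∣⁅x⁆∪p∩q∣≡∣q[x]∣+∣p∩q∣ zero (false ∷ p) (y ∷ q) _
  rewrite ∪-identityˡ p = ∣x∷p∣≡∣x∷[]∣+∣p∣ y (p ∩ q)
x∉p⇒∣⁅x⁆∪p∩q∣≡∣q[x]∣+∣p∩q∣ (suc x) (s ∷ p) (y ∷ q) x∉p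
  with s ∧ y | x∉p⇒∣⁅x⁆∪p∩q∣≡∣q[x]∣+∣p∩q∣ x p q (x∉p ∘ there)
... | true  | ih = trans (cong suc ih) (sym (ℕₚ.+-suc _ _))
... | false | ih = ih

∣⁅x⁆∩p∣≡∣p[x]∣ : ∀ (x : Fin n) p → ∣ ⁅ x ⁆ ∩ p ∣ ≡ ∣ lookup p x ∷ [] ∣
∣⁅x⁆∩p∣≡∣p[x]∣ {n} x p = begin
  ∣ ⁅ x ⁆ ∩ p ∣                   ≡⟨ cong (λ s → ∣ s ∩ p ∣) (sym (∪-identityʳ ⁅ x ⁆)) ⟩
  ∣ (⁅ x ⁆ ∪ ⊥) ∩ p ∣             ≡⟨ x∉p⇒∣⁅x⁆∪p∩q∣≡∣q[x]∣+∣p∩q∣ x ⊥ p ∉⊥ ⟩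
  ∣ lookup p x ∷ [] ∣ + ∣ ⊥ ∩ p ∣ ≡⟨ cong (λ s → ∣ lookup p x ∷ [] ∣ + ∣ s ∣) (∩-zeroˡ p) ⟩
  ∣ lookup p x ∷ [] ∣ + ∣ ⊥ {n} ∣ ≡⟨ cong (∣ lookup p x ∷ [] ∣ +_) (∣⊥∣≡0 n) ⟩
  ∣ lookup p x ∷ [] ∣ + 0         ≡⟨ ℕₚ.+-identityʳ _ ⟩
  ∣ lookup p x ∷ [] ∣             ∎
  where open ≡-Reasoning

module _ {u v w : Fin n} where

  ∈-triple₁ : u ∈ triple u v w
  ∈-triple₁ = x∈p∪q⁺ (inj₁ (x∈⁅x⁆ u))

  ∈-triple₂ : v ∈ triple u v w
  ∈-triple₂ = x∈p∪q⁺ (inj₂ (x∈p∪q⁺ (inj₁ (x∈⁅x⁆ v))))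

  ∈-triple₃ : w ∈ triple u v w
  ∈-triple₃ = x∈p∪q⁺ (inj₂ (x∈p∪q⁺ {p = ⁅ v ⁆} (inj₂ (x∈⁅x⁆ w))))

  ∈-triple⁻ : ∀ {x} → x ∈ triple u v w → x ≡ u ⊎ x ≡ v ⊎ x ≡ w
  ∈-triple⁻ x∈ with x∈p∪q⁻ ⁅ u ⁆ (⁅ v ⁆ ∪ ⁅ w ⁆) x∈
  ... | inj₁ x∈u = inj₁ (x∈⁅y⁆⇒x≡y u x∈u)
  ... | inj₂ x∈vw with x∈p∪q⁻ ⁅ v ⁆ ⁅ w ⁆ x∈vw
  ...   | inj₁ x∈v = inj₂ (inj₁ (x∈⁅y⁆⇒x≡y v x∈v))
  ...   | inj₂ x∈w = inj₂ (inj₂ (x∈⁅y⁆⇒x≡y w x∈w))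

  triple-swap₁₂ : triple u v w ≡ triple v u w
  triple-swap₁₂ = trans (sym (∪-assoc ⁅ u ⁆ ⁅ v ⁆ ⁅ w ⁆))
                        (trans (cong (_∪ ⁅ w ⁆) (∪-comm ⁅ u ⁆ ⁅ v ⁆)) (∪-assoc ⁅ v ⁆ ⁅ u ⁆ ⁅ w ⁆))

  triple-swap₂₃ : triple u v w ≡ triple u w v
  triple-swap₂₃ = cong (⁅ u ⁆ ∪_) (∪-comm ⁅ v ⁆ ⁅ w ⁆)

  ∣triple∩p∣≡∣p[u,v,w]∣ : ∀ p → u ≢ v → u ≢ w → v ≢ w →
                          ∣ triple u v w ∩ p ∣ ≡ ∣ map (lookup p) (u ∷ v ∷ w ∷ []) ∣
  ∣triple∩p∣≡∣p[u,v,w]∣ p u≢v u≢w v≢w = begin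
    ∣ triple u v w ∩ p ∣
      ≡⟨ x∉p⇒∣⁅x⁆∪p∩q∣≡∣q[x]∣+∣p∩q∣ u _ p (x∉⁅y⁆∪⁅z⁆ u≢v u≢w) ⟩
    ∣ p[ u ] ∣ + ∣ (⁅ v ⁆ ∪ ⁅ w ⁆) ∩ p ∣
      ≡⟨ cong (∣ p[ u ] ∣ +_) (x∉p⇒∣⁅x⁆∪p∩q∣≡∣q[x]∣+∣p∩q∣ v _ p (x≢y⇒x∉⁅y⁆ v≢w)) ⟩
    ∣ p[ u ] ∣ + (∣ p[ v ] ∣ + ∣ ⁅ w ⁆ ∩ p ∣)
      ≡⟨ cong (λ k → ∣ p[ u ] ∣ + (∣ p[ v ] ∣ + k)) (∣⁅x⁆∩p∣≡∣p[x]∣ w p) ⟩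
    ∣ p[ u ] ∣ + (∣ p[ v ] ∣ + ∣ p[ w ] ∣)
      ≡⟨ sym (cong (∣ p[ u ] ∣ +_) (∣x∷p∣≡∣x∷[]∣+∣p∣ (lookup p v) (lookup p w ∷ []))) ⟩
    ∣ p[ u ] ∣ + ∣ lookup p v ∷ lookup p w ∷ [] ∣
      ≡⟨ sym (∣x∷p∣≡∣x∷[]∣+∣p∣ (lookup p u) (lookup p v ∷ lookup p w ∷ [])) ⟩
    ∣ lookup p u ∷ lookup p v ∷ lookup p w ∷ [] ∣ ∎
    where
    open ≡-Reasoning
    p[_] : Fin n → Subset 1
    p[ x ] = lookup p x ∷ []

triple-rotate : triple u v w ≡ triple v w u
triple-rotate = trans triple-swap₁₂ triple-swap₂₃

∣p∣≡1+k⇒p≡⁅x⁆∪q : ∀ (p : Subset n) {k} → ∣ p ∣ ≡ suc k → ∃₂ λ x q → ∣ q ∣ ≡ k × p ≡ ⁅ x ⁆ ∪ q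
∣p∣≡1+k⇒p≡⁅x⁆∪q (true ∷ p) ∣p∣≡ =
  zero , false ∷ p , ℕₚ.suc-injective ∣p∣≡ , cong (true ∷_) (sym (∪-identityˡ p))
∣p∣≡1+k⇒p≡⁅x⁆∪q (false ∷ p) ∣p∣≡ with ∣p∣≡1+k⇒p≡⁅x⁆∪q p ∣p∣≡
... | x , q , ∣q∣≡ , p≡ = suc x , false ∷ q , ∣q∣≡ , cong (false ∷_) p≡

∣p∣≡0⇒p≡⊥ : ∀ (p : Subset n) → ∣ p ∣ ≡ 0 → p ≡ ⊥
∣p∣≡0⇒p≡⊥ []          _    = refl
∣p∣≡0⇒p≡⊥ (false ∷ p) ∣p∣≡ = cong (false ∷_) (∣p∣≡0⇒p≡⊥ p ∣p∣≡)

∣p∣≡3⇒triple : ∀ (p : Subset n) → ∣ p ∣ ≡ 3 → ∃₂ λ u v → ∃ λ w → p ≡ triple u v w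
∣p∣≡3⇒triple p ∣p∣≡3 with ∣p∣≡1+k⇒p≡⁅x⁆∪q p ∣p∣≡3
... | u , p₁ , ∣p₁∣≡2 , p≡ with ∣p∣≡1+k⇒p≡⁅x⁆∪q p₁ ∣p₁∣≡2
...   | v , p₂ , ∣p₂∣≡1 , p₁≡ with ∣p∣≡1+k⇒p≡⁅x⁆∪q p₂ ∣p₂∣≡1
...     | w , p₃ , ∣p₃∣≡0 , p₂≡ = u , v , w ,
  trans p≡ (cong (⁅ u ⁆ ∪_) (trans p₁≡ (cong (⁅ v ⁆ ∪_)
    (trans p₂≡ (trans (cong (⁅ w ⁆ ∪_) (∣p∣≡0⇒p≡⊥ p₃ ∣p₃∣≡0)) (∪-identityʳ ⁅ w ⁆))))))

girth-weaken : ∀ {g g′} → g′ ≤ g → GirthAtLeast H g → GirthAtLeast H g′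
girth-weaken g′≤g girth k 2≤ <g′ = girth k 2≤ (ℕₚ.≤-trans <g′ g′≤g)

module Edges {n} (H : Hypergraph3 n) where

  edge-swap₁₂ : IsEdge H u v w → IsEdge H v u w
  edge-swap₁₂ = subst (E H) triple-swap₁₂

  edge-swap₂₃ : IsEdge H u v w → IsEdge H u w v
  edge-swap₂₃ = subst (E H) triple-swap₂₃

  edge-rotate : IsEdge H u v w → IsEdge H v w u
  edge-rotate = subst (E H) triple-rotate

  edge-distinct : IsEdge H u v w → u ≢ v × u ≢ w × v ≢ w
  edge-distinct {u} {v} {w} e = u≢v , u≢w , v≢w
    where
    ∣⁅x⁆∪⁅y⁆∣≤2 : ∀ x y → ∣ ⁅ x ⁆ ∪ ⁅ y ⁆ ∣ ≤ 2
    ∣⁅x⁆∪⁅y⁆∣≤2 x y = subst (λ k → ∣ ⁅ x ⁆ ∪ ⁅ y ⁆ ∣ ≤ suc k) (∣⁅x⁆∣≡1 y) (∣⁅x⁆∪p∣≤1+∣p∣ x ⁅ y ⁆)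
    not-small : ¬ ∣ triple u v w ∣ ≤ 2
    not-small ≤2 = ℕₚ.<-irrefl refl (subst (_≤ 2) (uniform H e) ≤2)
    u∉⁅v⁆∪⁅w⁆ : u ∉ ⁅ v ⁆ ∪ ⁅ w ⁆
    u∉⁅v⁆∪⁅w⁆ u∈ = not-small (subst (λ s → ∣ s ∣ ≤ 2) (sym (x∈p⇒⁅x⁆∪p≡p u∈)) (∣⁅x⁆∪⁅y⁆∣≤2 v w))
    u≢v : u ≢ v
    u≢v refl = u∉⁅v⁆∪⁅w⁆ (x∈p∪q⁺ (inj₁ (x∈⁅x⁆ u)))
    u≢w : u ≢ w
    u≢w refl = u∉⁅v⁆∪⁅w⁆ (x∈p∪q⁺ (inj₂ (x∈⁅x⁆ u)))
    v≢w : v ≢ w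
    v≢w refl = not-small (subst (λ s → ∣ ⁅ u ⁆ ∪ s ∣ ≤ 2) (sym (∪-idem ⁅ v ⁆)) (∣⁅x⁆∪⁅y⁆∣≤2 u v))

  two-cycle : ∀ {u v e e′} → u ≢ v → e ≢ e′ → E H e → E H e′ →
              u ∈ e → v ∈ e → u ∈ e′ → v ∈ e′ → Cycle H 1
  two-cycle {u} {v} {e} {e′} u≢v e≢e′ Ee Ee′ u∈e v∈e u∈e′ v∈e′ = record
    { vs = vs ; es = es ; es-edge = es-edge ; vs-inj = vs-inj ; es-inj = es-inj ; link = link }
    where
    vs : Fin 2 → Fin n
    vs zero    = u
    vs (suc _) = v
    es : Fin 2 → Subset n
    es zero    = e
    es (suc _) = e′
    es-edge : ∀ i → E H (es i)
    es-edge zero       = Ee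
    es-edge (suc zero) = Ee′
    vs-inj : ∀ {i j} → vs i ≡ vs j → i ≡ j
    vs-inj {zero}     {zero}     _ = refl
    vs-inj {zero}     {suc zero} p = ⊥-elim (u≢v p)
    vs-inj {suc zero} {zero}     p = ⊥-elim (u≢v (sym p))
    vs-inj {suc zero} {suc zero} _ = refl
    es-inj : ∀ {i j} → es i ≡ es j → i ≡ j
    es-inj {zero}     {zero}     _ = refl
    es-inj {zero}     {suc zero} p = ⊥-elim (e≢e′ p)
    es-inj {suc zero} {zero}     p = ⊥-elim (e≢e′ (sym p))
    es-inj {suc zero} {suc zero} _ = refl
    link : ∀ i → vs (next i) ∈ es i × vs (next i) ∈ es (next i)
    link zero       = v∈e , v∈e′
    link (suc zero) = u∈e′ , u∈e

  edge-through-pair-unique : GirthAtLeast H 3 → ∀ {u v e e′} → u ≢ v → E H e → E H e′ →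
                             u ∈ e → v ∈ e → u ∈ e′ → v ∈ e′ → e ≡ e′
  edge-through-pair-unique girth u≢v Ee Ee′ u∈e v∈e u∈e′ v∈e′ =
    decidable-stable (Vecₚ.≡-dec Boolₚ._≟_ _ _)
      (λ e≢e′ → girth 1 ℕₚ.≤-refl ℕₚ.≤-refl (two-cycle u≢v e≢e′ Ee Ee′ u∈e v∈e u∈e′ v∈e′))

  third-vertex-unique : GirthAtLeast H 3 → ∀ {u v z z′} → IsEdge H u v z → IsEdge H u v z′ → z ≡ z′
  third-vertex-unique girth e e′ with edge-distinct e
  ... | u≢v , u≢z , v≢z
      with ∈-triple⁻ (subst (_ ∈_) (edge-through-pair-unique girth u≢v e e′
                                      ∈-triple₁ ∈-triple₂ ∈-triple₁ ∈-triple₂) ∈-triple₃)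
  ...   | inj₁ z≡u         = ⊥-elim (u≢z (sym z≡u))
  ...   | inj₂ (inj₁ z≡v)  = ⊥-elim (v≢z (sym z≡v))
  ...   | inj₂ (inj₂ z≡z′) = z≡z′

-- The separating words

Triple : ℕ → Set
Triple n = Fin n × Fin n × Fin n

block : Triple n → Word n
block (u , v , w) = 𝐭 ∷ₗ ⟨ u ⟩ ∷ₗ ⟨ v ⟩ ∷ₗ ⟨ w ⟩ ∷ₗ []ₗ

separator : List (Triple n) → Word n
separator l = concatMap block l ++ 𝐭 ∷ₗ []ₗ

separator-head : ∀ (l : List (Triple n)) → ∃ λ s → separator l ≡ 𝐭 ∷ₗ s
separator-head []ₗ      = []ₗ , refl
separator-head (_ ∷ₗ _) = _ , refl

block-infix : ∀ {t} {l : List (Triple n)} → t List.∈ l →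
              ∃₂ λ p s → separator l ≡ p ++ (block t ++ 𝐭 ∷ₗ []ₗ) ++ s
block-infix {t = t} {_ ∷ₗ l} (here refl) with separator-head l
... | s , sep≡ = []ₗ , s , cong (block t ++_) sep≡
block-infix {l = t′ ∷ₗ _} (there t∈l) with block-infix t∈l
... | p , s , sep≡ = block t′ ++ p , s , cong (block t′ ++_) sep≡

IsEdgeTriple : Hypergraph3 n → Triple n → Set
IsEdgeTriple H (u , v , w) = IsEdge H u v w

isEdgeTriple? : ∀ (H : Hypergraph3 n) → Decidable (IsEdgeTriple H)
isEdgeTriple? H (u , v , w) = E? H (triple u v w)

allTriples : ∀ n → List (Triple n)
allTriples n = cartesianProduct (allFin n) (cartesianProduct (allFin n) (allFin n))

edgeTriples : Hypergraph3 n → List (Triple n)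
edgeTriples H = filter (isEdgeTriple? H) (allTriples _)

∈-edgeTriples : IsEdge H u v w → (u , v , w) List.∈ edgeTriples H
∈-edgeTriples {H = H} =
  ∈-filter⁺ (isEdgeTriple? H)
            (∈-cartesianProduct⁺ (∈-allFin _) (∈-cartesianProduct⁺ (∈-allFin _) (∈-allFin _)))

edgeTriples-edges : ∀ (H : Hypergraph3 n) → All (IsEdgeTriple H) (edgeTriples H)
edgeTriples-edges H = all-filter (isEdgeTriple? H) (allTriples _)

separatingWord : Hypergraph3 n → Word n
separatingWord H = separator (edgeTriples H)

-- Words act on the left, so they are read from the right: the block 𝐭 u v w
-- of an edge leads from start through read₁ w, awaiting u and complete back
-- to start.  Linearity (girth ≥ 3) makes afterPair, hence the action, respect
-- the defining relations.
module Automaton {n} (H : Hypergraph3 n) (girth : GirthAtLeast H 3) where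

  open Edges H

  data State : Set where
    dead start complete : State
    read₁ awaiting      : Fin n → State

  afterPair : Fin n → Fin n → State
  afterPair u v with any? (λ z → E? H (triple u v z))
  ... | yes (z , _) = awaiting z
  ... | no _        = dead

  actV : Fin n → State → State
  actV u dead         = dead
  actV u start        = read₁ u
  actV u (read₁ v)    = afterPair u v
  actV u (awaiting z) = if does (u Finₚ.≟ z) then complete else dead
  actV u complete     = dead

  act : Gen n → State → State
  act 𝟘     _        = dead
  act 𝐭     complete = start
  act 𝐭     _        = dead
  act ⟨ u ⟩ q        = actV u q

  run : Word n → State → State
  run w q = foldr act q w

  run-++ : ∀ x y q → run (x ++ y) q ≡ run x (run y q)
  run-++ x y q = foldr-++ act q x y

  act-dead : ∀ g → act g dead ≡ dead
  act-dead 𝟘     = refl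
  act-dead 𝐭     = refl
  act-dead ⟨ _ ⟩ = refl

  run-dead : ∀ w → run w dead ≡ dead
  run-dead []ₗ      = refl
  run-dead (g ∷ₗ w) = trans (cong (act g) (run-dead w)) (act-dead g)

  afterPair-edge : IsEdge H u v w → afterPair u v ≡ awaiting w
  afterPair-edge {u} {v} {w} e with any? (λ z → E? H (triple u v z))
  ... | yes (z , e′) = cong awaiting (third-vertex-unique girth e′ e)
  ... | no ∄z        = ⊥-elim (∄z (w , e))

  afterPair-no-edge : (∀ w → ¬ IsEdge H u v w) → afterPair u v ≡ dead
  afterPair-no-edge {u} {v} ∄w with any? (λ z → E? H (triple u v z))
  ... | yes (z , e) = ⊥-elim (∄w z e)
  ... | no _        = refl

  afterPair-comm : ∀ u v → afterPair u v ≡ afterPair v u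
  afterPair-comm u v with any? (λ z → E? H (triple u v z))
  ... | yes (z , e) = sym (afterPair-edge (edge-swap₁₂ e))
  ... | no ∄z       = sym (afterPair-no-edge (λ z e → ∄z (z , edge-swap₁₂ e)))

  afterPair-uncovered : NotCovered H u v → afterPair u v ≡ dead
  afterPair-uncovered nc = afterPair-no-edge (λ w e → nc (_ , e , ∈-triple₁ , ∈-triple₂))

  afterPair-PairEquiv : ∀ {x y} → PairEquiv H u v x y → afterPair u v ≡ afterPair x y
  afterPair-PairEquiv (inj₁ (w , e , e′)) = trans (afterPair-edge e) (sym (afterPair-edge e′))
  afterPair-PairEquiv (inj₂ (nc , nc′))   =
    trans (afterPair-uncovered nc) (sym (afterPair-uncovered nc′))

  afterPair≢complete : ∀ u v → afterPair u v ≢ complete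
  afterPair≢complete u v with any? (λ z → E? H (triple u v z))
  ... | yes _ = λ ()
  ... | no _  = λ ()

  ifEdge : Subset n → State
  ifEdge e = if does (E? H e) then complete else dead

  actV-afterPair : ∀ u v w → actV u (afterPair v w) ≡ ifEdge (triple v w u)
  actV-afterPair u v w with any? (λ z → E? H (triple v w z))
  ... | no ∄z = sym (cong (if_then complete else dead) (dec-false (E? H _) (λ e → ∄z (u , e))))
  ... | yes (z , e) with u Finₚ.≟ z
  ...   | yes refl = sym (cong (if_then complete else dead) (dec-true (E? H _) e))
  ...   | no u≢z   = sym (cong (if_then complete else dead)
                              (dec-false (E? H _) (λ e′ → u≢z (third-vertex-unique girth e′ e))))

  -- Two vertices act only through afterPair; this is what validates the pair relations.
  actPair : State → State → State
  actPair t start     = t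
  actPair t (read₁ w) = actV w t
  actPair t _         = dead

  actV∘actV≡actPair : ∀ u v q → actV u (actV v q) ≡ actPair (afterPair u v) q
  actV∘actV≡actPair u v dead         = refl
  actV∘actV≡actPair u v start        = refl
  actV∘actV≡actPair u v (read₁ w)    = begin
    actV u (afterPair v w) ≡⟨ actV-afterPair u v w ⟩
    ifEdge (triple v w u)  ≡⟨ cong ifEdge (sym triple-rotate) ⟩
    ifEdge (triple u v w)  ≡⟨ sym (actV-afterPair w u v) ⟩
    actV w (afterPair u v) ∎
    where open ≡-Reasoning
  actV∘actV≡actPair u v (awaiting z) with v Finₚ.≟ z
  ... | yes _ = refl
  ... | no _  = refl
  actV∘actV≡actPair u v complete     = refl

  actV²-cong : ∀ {x y} → afterPair u v ≡ afterPair x y →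
               ∀ q → actV u (actV v q) ≡ actV x (actV y q)
  actV²-cong {u} {v} {x} {y} eq q =
    trans (actV∘actV≡actPair u v q)
          (trans (cong (λ t → actPair t q) eq) (sym (actV∘actV≡actPair x y q)))

  actV²-dead : afterPair u v ≡ dead → ∀ q → actV u (actV v q) ≡ dead
  actV²-dead {u} {v} eq q =
    trans (actV∘actV≡actPair u v q) (trans (cong (λ t → actPair t q) eq) (actPair-dead q))
    where
    actPair-dead : ∀ q → actPair dead q ≡ dead
    actPair-dead dead         = refl
    actPair-dead start        = refl
    actPair-dead (read₁ _)    = refl
    actPair-dead (awaiting _) = refl
    actPair-dead complete     = refl

  actEdge : State → State
  actEdge start = complete
  actEdge _     = dead

  actV³≡actEdge : IsEdge H u v w → ∀ q → actV u (actV v (actV w q)) ≡ actEdge q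
  actV³≡actEdge {u} {v} {w} e q =
    trans (actV∘actV≡actPair u v (actV w q))
          (trans (cong (λ t → actPair t (actV w q)) (afterPair-edge e)) (actPair-awaiting q))
    where
    actPair-awaiting : ∀ q → actPair (awaiting w) (actV w q) ≡ actEdge q
    actPair-awaiting dead         = refl
    actPair-awaiting start        = cong (if_then complete else dead) (dec-true (w Finₚ.≟ w) refl)
    actPair-awaiting (read₁ x) with any? (λ z → E? H (triple w x z))
    ... | yes _ = refl
    ... | no _  = refl
    actPair-awaiting (awaiting z) with w Finₚ.≟ z
    ... | yes _ = refl
    ... | no _  = refl
    actPair-awaiting complete     = refl

  run-𝐭x𝐭≡dead : ∀ x → run x start ≢ complete → ∀ q → run (𝐭 ∷ₗ x ++ 𝐭 ∷ₗ []ₗ) q ≡ dead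
  run-𝐭x𝐭≡dead x x≢complete q = trans (cong (act 𝐭) (run-++ x (𝐭 ∷ₗ []ₗ) q)) (after-𝐭 q)
    where
    act𝐭-incomplete : ∀ q → q ≢ complete → act 𝐭 q ≡ dead
    act𝐭-incomplete dead         _ = refl
    act𝐭-incomplete start        _ = refl
    act𝐭-incomplete (read₁ _)    _ = refl
    act𝐭-incomplete (awaiting _) _ = refl
    act𝐭-incomplete complete     c = ⊥-elim (c refl)
    after-𝐭 : ∀ q → act 𝐭 (run x (act 𝐭 q)) ≡ dead
    after-𝐭 dead         = cong (act 𝐭) (run-dead x)
    after-𝐭 start        = cong (act 𝐭) (run-dead x)
    after-𝐭 (read₁ _)    = cong (act 𝐭) (run-dead x)
    after-𝐭 (awaiting _) = cong (act 𝐭) (run-dead x)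
    after-𝐭 complete     = act𝐭-incomplete _ x≢complete

  act𝐭∘actEdge∘act𝐭≡act𝐭 : ∀ q → act 𝐭 (actEdge (act 𝐭 q)) ≡ act 𝐭 q
  act𝐭∘actEdge∘act𝐭≡act𝐭 dead         = refl
  act𝐭∘actEdge∘act𝐭≡act𝐭 start        = refl
  act𝐭∘actEdge∘act𝐭≡act𝐭 (read₁ _)    = refl
  act𝐭∘actEdge∘act𝐭≡act𝐭 (awaiting _) = refl
  act𝐭∘actEdge∘act𝐭≡act𝐭 complete     = refl

  actEdge∘act𝐭∘actEdge≡actEdge : ∀ q → actEdge (act 𝐭 (actEdge q)) ≡ actEdge q
  actEdge∘act𝐭∘actEdge≡actEdge dead         = refl
  actEdge∘act𝐭∘actEdge≡actEdge start        = refl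
  actEdge∘act𝐭∘actEdge≡actEdge (read₁ _)    = refl
  actEdge∘act𝐭∘actEdge≡actEdge (awaiting _) = refl
  actEdge∘act𝐭∘actEdge≡actEdge complete     = refl

  run-Rel : ∀ {l r} → Rel H l r → ∀ q → run l q ≡ run r q
  run-Rel (zeroˡ _)           _ = refl
  run-Rel (zeroʳ g)           _ = act-dead g
  run-Rel tt                    = run-𝐭x𝐭≡dead []ₗ (λ ())
  run-Rel (tut u)               = run-𝐭x𝐭≡dead (⟨ u ⟩ ∷ₗ []ₗ) (λ ())
  run-Rel (tuvt u v)            = run-𝐭x𝐭≡dead (⟨ u ⟩ ∷ₗ ⟨ v ⟩ ∷ₗ []ₗ) (afterPair≢complete u v)
  run-Rel (comm u v)            = actV²-cong (afterPair-comm u v)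
  run-Rel (square u)            = actV²-dead (afterPair-no-edge (λ _ e → proj₁ (edge-distinct e) refl))
  run-Rel (uncov u v nc)        = actV²-dead (afterPair-uncovered nc)
  run-Rel (tuvwt u v w e)     q =
    trans (cong (act 𝐭) (actV³≡actEdge e (act 𝐭 q))) (act𝐭∘actEdge∘act𝐭≡act𝐭 q)
  run-Rel (edges _ _ _ _ _ _ e e′) q =
    trans (actV³≡actEdge e q) (sym (actV³≡actEdge e′ q))
  run-Rel (ete u v w e)       q = begin
    actV u (actV v (actV w (act 𝐭 (actV u (actV v (actV w q))))))
      ≡⟨ actV³≡actEdge e _ ⟩
    actEdge (act 𝐭 (actV u (actV v (actV w q))))
      ≡⟨ cong (actEdge ∘ act 𝐭) (actV³≡actEdge e q) ⟩
    actEdge (act 𝐭 (actEdge q))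
      ≡⟨ actEdge∘act𝐭∘actEdge≡actEdge q ⟩
    actEdge q
      ≡⟨ sym (actV³≡actEdge e q) ⟩
    actV u (actV v (actV w q)) ∎
    where open ≡-Reasoning
  run-Rel (pairs _ _ _ _ _ _ pe) = actV²-cong (afterPair-PairEquiv pe)

  run-∼ : ∀ {x y} → _∼_ H x y → ∀ q → run x q ≡ run y q
  run-∼ (step {l} {r} ρ p s) q = begin
    run (p ++ l ++ s) q     ≡⟨ run-++ p (l ++ s) q ⟩
    run p (run (l ++ s) q)  ≡⟨ cong (run p) (run-++ l s q) ⟩
    run p (run l (run s q)) ≡⟨ cong (run p) (run-Rel ρ (run s q)) ⟩
    run p (run r (run s q)) ≡⟨ cong (run p) (sym (run-++ r s q)) ⟩
    run p (run (r ++ s) q)  ≡⟨ sym (run-++ p (r ++ s) q) ⟩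
    run (p ++ r ++ s) q     ∎
    where open ≡-Reasoning
  run-∼ ∼refl           q = refl
  run-∼ (∼sym x∼y)      q = sym (run-∼ x∼y q)
  run-∼ (∼trans x∼y y∼z) q = trans (run-∼ x∼y q) (run-∼ y∼z q)

  run-blocks-start : ∀ {l} → All (IsEdgeTriple H) l → run (concatMap block l) start ≡ start
  run-blocks-start []ᵃ = refl
  run-blocks-start {(u , v , w) ∷ₗ _} (e ∷ᵃ es) =
    trans (cong (λ q → act 𝐭 (actV u (actV v (actV w q)))) (run-blocks-start es))
          (cong (act 𝐭) (actV³≡actEdge e start))

  separator-separates : ∀ {l} → All (IsEdgeTriple H) l →
                        ¬ (_∼_ H (separator l) (separator l ++ 𝐭 ∷ₗ []ₗ))
  separator-separates {l} es sep = start≢dead (begin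
    start                                       ≡⟨ sym (run-blocks-start es) ⟩
    run (concatMap block l) start               ≡⟨ sym (run-++ (concatMap block l) _ complete) ⟩
    run (separator l) complete                  ≡⟨ run-∼ sep complete ⟩
    run (separator l ++ 𝐭 ∷ₗ []ₗ) complete      ≡⟨ run-++ (separator l) _ complete ⟩
    run (separator l) start                     ≡⟨ run-++ (concatMap block l) _ start ⟩
    run (concatMap block l) dead                ≡⟨ run-dead (concatMap block l) ⟩
    dead                                        ∎)
    where
    open ≡-Reasoning
    start≢dead : start ≢ dead
    start≢dead ()

code : Gen n → ℕ
code 𝟘     = 0
code 𝐭     = 1
code ⟨ v ⟩ = suc (suc (toℕ v))

decode : ℕ → Gen n
decode zero       = 𝟘
decode (suc zero) = 𝐭
decode {n} (suc (suc k)) with k <? n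
... | yes k<n = ⟨ fromℕ< k<n ⟩
... | no _    = 𝟘

decode-code : ∀ (g : Gen n) → decode (code g) ≡ g
decode-code 𝟘 = refl
decode-code 𝐭 = refl
decode-code {n} ⟨ v ⟩ with toℕ v <? n
... | yes v<n = cong ⟨_⟩ (Finₚ.fromℕ<-toℕ v v<n)
... | no v≮n  = ⊥-elim (v≮n (Finₚ.toℕ<n v))

encode : Word n → Term
encode = mapₗ code

satisfies⇒∼ : ∀ (H : Hypergraph3 n) {x y} → Satisfies (M H) (encode x) (encode y) → _∼_ H x y
satisfies⇒∼ H {x} {y} sat = subst₂ (_∼_ H) (eval-letters x) (eval-letters y) (sat letter)
  where
  letter : ℕ → Word _
  letter k = decode k ∷ₗ []ₗ
  eval-letters : ∀ w → eval (M H) letter (encode w) ≡ w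
  eval-letters []ₗ      = refl
  eval-letters (g ∷ₗ w) = cong₂ _∷ₗ_ (decode-code g) (eval-letters w)

evalᴮ : (ℕ → B₂¹) → Word n → B₂¹
evalᴮ σ w = eval B₂¹-monoid σ (encode w)

evalᴮ-++ : ∀ σ (x y : Word n) → evalᴮ σ (x ++ y) ≡ evalᴮ σ x ·ᴮ evalᴮ σ y
evalᴮ-++ σ []ₗ      y = sym (·ᴮ-identityˡ _)
evalᴮ-++ σ (g ∷ₗ x) y = trans (cong (σ (code g) ·ᴮ_) (evalᴮ-++ σ x y)) (sym (·ᴮ-assoc _ _ _))

evalᴮ-factor-≢𝟎 : ∀ σ (p m s : Word n) → evalᴮ σ (p ++ m ++ s) ≢ 𝟎 → evalᴮ σ m ≢ 𝟎
evalᴮ-factor-≢𝟎 σ p m s ≢𝟎 m≡𝟎 = ≢𝟎 (begin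
  evalᴮ σ (p ++ m ++ s)                    ≡⟨ evalᴮ-++ σ p (m ++ s) ⟩
  evalᴮ σ p ·ᴮ evalᴮ σ (m ++ s)            ≡⟨ cong (evalᴮ σ p ·ᴮ_) (evalᴮ-++ σ m s) ⟩
  evalᴮ σ p ·ᴮ (evalᴮ σ m ·ᴮ evalᴮ σ s)   ≡⟨ cong (λ x → evalᴮ σ p ·ᴮ (x ·ᴮ evalᴮ σ s)) m≡𝟎 ⟩
  evalᴮ σ p ·ᴮ (𝟎 ·ᴮ evalᴮ σ s)           ≡⟨ cong (evalᴮ σ p ·ᴮ_) (·ᴮ-zeroˡ _) ⟩
  evalᴮ σ p ·ᴮ 𝟎                           ≡⟨ ·ᴮ-zeroʳ _ ⟩
  𝟎                                        ∎)
  where open ≡-Reasoning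

-- Assignments in B₂¹ separating the words

module SeparatingAssignment {n} (H : Hypergraph3 n) (σ : ℕ → B₂¹)
  (separates : evalᴮ σ (separatingWord H) ≢ evalᴮ σ (separatingWord H ++ 𝐭 ∷ₗ []ₗ))
  where

  open Edges H
  open ≡-Reasoning

  t : B₂¹
  t = σ (code {n} 𝐭)

  X : Fin n → B₂¹
  X v = σ (code ⟨ v ⟩)

  colour : Fin n → Bool
  colour = isOne ∘ X

  B W : Word n
  B = concatMap block (edgeTriples H)
  W = separatingWord H

  evalᴮ-∷𝐭 : ∀ (x : Word n) → evalᴮ σ (x ++ 𝐭 ∷ₗ []ₗ) ≡ evalᴮ σ x ·ᴮ t
  evalᴮ-∷𝐭 x = trans (evalᴮ-++ σ x (𝐭 ∷ₗ []ₗ)) (cong (evalᴮ σ x ·ᴮ_) (·ᴮ-identityʳ t))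

  W≢𝟎 : evalᴮ σ W ≢ 𝟎
  W≢𝟎 W≡𝟎 = separates (begin
    evalᴮ σ W                   ≡⟨ W≡𝟎 ⟩
    𝟎                           ≡⟨ sym (·ᴮ-zeroˡ t) ⟩
    𝟎 ·ᴮ t                      ≡⟨ cong (_·ᴮ t) (sym W≡𝟎) ⟩
    evalᴮ σ W ·ᴮ t              ≡⟨ sym (evalᴮ-∷𝐭 W) ⟩
    evalᴮ σ (W ++ 𝐭 ∷ₗ []ₗ)     ∎)

  t·t≢t : t ·ᴮ t ≢ t
  t·t≢t t·t≡t = separates (begin
    evalᴮ σ W                   ≡⟨ evalᴮ-∷𝐭 B ⟩
    evalᴮ σ B ·ᴮ t              ≡⟨ cong (evalᴮ σ B ·ᴮ_) (sym t·t≡t) ⟩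
    evalᴮ σ B ·ᴮ (t ·ᴮ t)       ≡⟨ sym (·ᴮ-assoc _ t t) ⟩
    (evalᴮ σ B ·ᴮ t) ·ᴮ t       ≡⟨ cong (_·ᴮ t) (sym (evalᴮ-∷𝐭 B)) ⟩
    evalᴮ σ W ·ᴮ t              ≡⟨ sym (evalᴮ-∷𝐭 W) ⟩
    evalᴮ σ (W ++ 𝐭 ∷ₗ []ₗ)     ∎)

  sandwiched : IsEdge H u v w → sandwich t (X u) (X v) (X w) ≢ 𝟎
  sandwiched {u} {v} {w} e with block-infix (∈-edgeTriples {H = H} e)
  ... | p , s , W≡ = λ ≡𝟎 → evalᴮ-factor-≢𝟎 σ p _ s (subst (λ x → evalᴮ σ x ≢ 𝟎) W≡ W≢𝟎)
    (trans (cong (λ r → t ·ᴮ (X u ·ᴮ (X v ·ᴮ (X w ·ᴮ r)))) (·ᴮ-identityʳ t)) ≡𝟎)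

  colour-isMajority : IsMajority2Colouring H colour
  colour-isMajority e Ee with ∣p∣≡3⇒triple e (uniform H Ee)
  ... | u , v , w , refl with edge-distinct Ee
  ...   | u≢v , u≢w , v≢w = begin
    ∣ triple u v w ∩ tabulate colour ∣
      ≡⟨ ∣triple∩p∣≡∣p[u,v,w]∣ _ u≢v u≢w v≢w ⟩
    ∣ map (lookup (tabulate colour)) (u ∷ v ∷ w ∷ []) ∣
      ≡⟨ cong ∣_∣ (map-cong (lookup∘tabulate colour) (u ∷ v ∷ w ∷ [])) ⟩
    ∣ map colour (u ∷ v ∷ w ∷ []) ∣
      ≡⟨ two-ones-in-sandwiched-triple t (X u) (X v) (X w) t·t≢t
           (sandwiched Ee) (sandwiched (edge-swap₂₃ Ee)) (sandwiched (edge-swap₁₂ Ee))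
           (sandwiched (edge-rotate Ee)) (sandwiched (edge-rotate (edge-rotate Ee)))
           (sandwiched (edge-swap₁₂ (edge-rotate Ee))) ⟩
    2 ∎

HasMajority2Colouring : Hypergraph3 n → Set
HasMajority2Colouring {n} H = ∃ λ (γ : Fin n → Bool) → IsMajority2Colouring H γ

hasMajority2Colouring? : ∀ (H : Hypergraph3 n) → Dec (HasMajority2Colouring H)
hasMajority2Colouring? H =
  map′ (λ (c , maj) → lookup c ,
                      subst (λ c′ → ∀ e → E H e → ∣ e ∩ c′ ∣ ≡ 2) (sym (tabulate∘lookup c)) maj)
       (λ (γ , maj) → tabulate γ , maj)
       (anySubset? λ c → allSubset? λ e → E? H e →-dec ∣ e ∩ c ∣ ℕₚ.≟ 2)

B₂¹-satisfies-separatingWord : ∀ (H : Hypergraph3 n) → ¬ HasMajority2Colouring H →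
  Satisfies B₂¹-monoid (encode (separatingWord H)) (encode (separatingWord H ++ 𝐭 ∷ₗ []ₗ))
B₂¹-satisfies-separatingWord H uncolourable σ =
  decidable-stable (_ ≟ᴮ _)
    (λ separates → uncolourable (_ , SeparatingAssignment.colour-isMajority H σ separates))

lemma2p9 : (n : ℕ) (H : Hypergraph3 n) → GirthAtLeast H 4 → In𝔹₂¹ (M H) →
    ∃ (λ (γ : Fin n → Bool) → IsMajority2Colouring H γ)
lemma2p9 n H girth inB with hasMajority2Colouring? H
... | yes colourable  = colourable
... | no uncolourable = ⊥-elim (separator-separates (edgeTriples-edges H) (satisfies⇒∼ H M⊨identity))
  where
  open Automaton H (girth-weaken (ℕₚ.n≤1+n 3) girth)
  W : Word n
  W = separatingWord H
  M⊨identity : Satisfies (M H) (encode W) (encode (W ++ 𝐭 ∷ₗ []ₗ))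
  M⊨identity = inB (encode W) (encode (W ++ 𝐭 ∷ₗ []ₗ)) (B₂¹-satisfies-separatingWord H uncolourable)
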